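{- Let $q$ be a prime, $F=\mathbb{Z}/q\mathbb{Z}$, $F^*=F\setminus\{0\}$, and let $A$ be a nonempty subset of $F^*$. Let $$H:=\Big\{s\in F:\ |\{(a,b):a,b\in A,\ s=a/b\}|\ge \frac{|A|^2}{5|A\cdot A|}\Big\},$$ and let $G$ be the subgroup of the multiplicative group $F^*$ generated by $H$. Then there is a coset $G_1$ of $G$ in $F^*$ such that $|A\cap G_1|\ge|A|/3$.
   Context: $A\cdot A:=\{ab:a,b\in A\}$. -}

module Defs where

open import Data.Nat using (ℕ; zero; suc; _+_; _*_; NonZero)
open import Data.Nat.DivMod using (_mod_)
open import Data.Fin using (Fin; toℕ)
open import Data.Fin.Properties using (any?; _≟_)
open import Data.Fin.Subset using (Subset; _∈_; ∣_∣)
open import Data.Fin.Subset.Properties using (_∈?_)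
open import Data.Vec using (tabulate)
open import Data.Vec.Functional using (foldr)
open import Data.Product using (∃; _×_)
open import Relation.Nullary using (does)
open import Relation.Nullary.Decidable using (_×-dec_)
open import Relation.Binary.PropositionalEquality using (_≡_)

-- F = ℤ/qℤ is represented by Fin q (residues 0..q-1).
-- Multiplication in F.
_·_ : ∀ {q} .{{_ : NonZero q}} → Fin q → Fin q → Fin q
_·_ {q} x y = (toℕ x * toℕ y) mod q
infixl 7 _·_

oneF : ∀ {q} .{{_ : NonZero q}} → Fin q
oneF {q} = 1 mod q

sumFin : ∀ {n} → (Fin n → ℕ) → ℕ
sumFin f = foldr _+_ 0 f

-- r_A(s) = |{(a,b) : a,b ∈ A, s = a/b}|, where (for b ≠ 0) s = a/b ⇔ s·b = a.
ratioCount : ∀ {q} .{{_ : NonZero q}} → Subset q → Fin q → ℕ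
ratioCount {q} A s =
  sumFin (λ a → ∣ tabulate (λ b → does ((a ∈? A) ×-dec ((b ∈? A) ×-dec (s · b ≟ a)))) ∣)

prodSet : ∀ {q} .{{_ : NonZero q}} → Subset q → Subset q
prodSet A = tabulate (λ c →
  does (any? (λ a → any? (λ b → (a ∈? A) ×-dec ((b ∈? A) ×-dec (a · b ≟ c))))))

-- H = {s ∈ F : r_A(s) ≥ |A|² / (5 |A·A|)}, cleared of denominators
-- (|A·A| > 0 since A is nonempty).
inH : ∀ {q} .{{_ : NonZero q}} → Subset q → Fin q → Set
inH A s = ∣ A ∣ * ∣ A ∣ Data.Nat.≤ 5 * (ratioCount A s * ∣ prodSet A ∣)

-- The subgroup of F* generated by a set H ⊆ F*: the smallest set containing 1
-- and closed under multiplication and division by elements of H.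
data Gen {q} .{{_ : NonZero q}} (H : Fin q → Set) : Fin q → Set where
  gen-one : Gen H oneF
  gen-mul : ∀ {h g} → H h → Gen H g → Gen H (h · g)
  gen-div : ∀ {h g x} → H h → Gen H g → h · x ≡ g → Gen H x

inCoset : ∀ {q} .{{_ : NonZero q}} → (Fin q → Set) → Fin q → Fin q → Set
inCoset G c x = ∃ λ g → G g × x ≡ c · g

module Submission where

-- Write D and S for the numbers of pairs in A² lying in different, resp. the same, coset
-- of G, so |A|² = D + S. If every coset met A in fewer than |A|/3 points, then S < |A|²/3,
-- so D > 2|A|²/3. If a and c lie in different cosets then a/c ∉ H, so a b = c d has fewer
-- than |A|²/(5|A·A|) solutions (b, d) ∈ A²; hence the number Q of solutions of a b = c d
-- in A⁴ with a, c in different cosets satisfies 5 |A·A| Q ≤ |A|² D. On the other hand the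
-- products of the D pairs (a, b) in different cosets lie in A·A, and two such pairs with
-- a b = c d have c or d in a different coset from a, so Cauchy–Schwarz gives
-- D² ≤ |A·A| · 2Q. Together 5 D² ≤ 2 |A|² D, i.e. D ≤ 2|A|²/5, a contradiction.

open import Defs
open import Data.Bool using (Bool; true; false; _∧_; not)
open import Data.Empty using (⊥; ⊥-elim)
open import Data.Fin using (Fin; zero; suc; toℕ; punchOut) renaming (_<_ to _<ᶠ_)
open import Data.Fin.Properties
  using (_≟_; any?; pigeonhole; punchOut-injective; toℕ-fromℕ<; toℕ-injective; toℕ<n)
  renaming (<⇒≢ to <ᶠ⇒≢)
open import Data.Fin.Subset using (Subset; _∈_; _⊆_; _⊂_; ∣_∣; inside; outside; ⁅_⁆; Nonempty)
open import Data.Fin.Subset.Properties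
  using (_∈?_; _⊂?_; ⊆-antisym; p⊂q⇒∣p∣<∣q∣; p⊆q⇒∣p∣≤∣q∣; ∣p∣≤n; x∈⁅x⁆; x∈⁅y⁆⇒x≡y; ∣⁅x⁆∣≡1)
open import Data.List using (List; length; filter; allFin)
import Data.List as List
open import Data.List.Relation.Unary.All using (All)
open import Data.List.Relation.Unary.All.Properties using (all-filter)
open import Data.List.Relation.Unary.Unique.Propositional using (Unique)
open import Data.List.Relation.Unary.Unique.Propositional.Properties using (filter⁺; allFin⁺)
open import Data.Nat
  using (ℕ; zero; suc; _+_; _*_; _∸_; _%_; _/_; _≤_; _<_; _≤?_; z≤n; s≤s; NonZero; ≢-nonZero; >-nonZero)
open import Data.Nat.Coprimality using (coprime-divisor; prime⇒coprime)
open import Data.Nat.Divisibility using (_∣_; divides; >⇒∤)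
open import Data.Nat.DivMod
  using (_mod_; m%n<n; m<n⇒m%n≡m; %-distribˡ-*; m%n%n≡m%n; m*n%n≡0; m≡m%n+[m/n]*n)
open import Data.Nat.GeneralisedArithmetic using (fold)
open import Data.Nat.Primality using (Prime)
open import Data.Nat.Properties hiding (_≟_)
open import Algebra.Properties.Semiring.Sum +-*-semiring
  using (sum; sum-cong-≗; sum-replicate-zero; ∑-distrib-+; ∑-comm; *-distribˡ-sum; *-distribʳ-sum)
open import Data.Nat.Tactic.RingSolver using (solve-∀)
open import Data.Product using (Σ; ∃; ∃₂; _×_; _,_)
open import Data.Sum using (_⊎_; inj₁; inj₂; [_,_]′)
open import Data.Vec using (tabulate; _∷_; [])
open import Data.Vec.Properties using (lookup∘tabulate; []=⇒lookup; lookup⇒[]=)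
open import Function using (_∘_; id)
open import Function.Bundles using (_⇔_; mk⇔)
open import Relation.Binary.PropositionalEquality
open import Relation.Nullary using (Dec; yes; no; does; ¬_; contradiction)
open import Relation.Nullary.Decidable using (dec-true; does-⇔; map′; _×-dec_; _⊎-dec_)
open import Relation.Unary using (Pred; Decidable)

-- Sums over Fin n

sum-mono-≤ : ∀ {n} {f g : Fin n → ℕ} → (∀ i → f i ≤ g i) → sum f ≤ sum g
sum-mono-≤ {zero}  _   = z≤n
sum-mono-≤ {suc n} f≤g = +-mono-≤ (f≤g zero) (sum-mono-≤ (f≤g ∘ suc))

2xy≤x²+y² : ∀ x y → 2 * (x * y) ≤ x * x + y * y
2xy≤x²+y² x y = [ ordered , swapped ]′ (≤-total x y)
  where
  expand : ∀ x d → 2 * (x * (x + d)) + d * d ≡ x * x + (x + d) * (x + d)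
  expand = solve-∀
  ordered : ∀ {x y} → x ≤ y → 2 * (x * y) ≤ x * x + y * y
  ordered {x} x≤y with d , refl ← m≤n⇒∃[o]m+o≡n x≤y =
    subst (2 * (x * (x + d)) ≤_) (expand x d) (m≤m+n _ (d * d))
  swapped : y ≤ x → 2 * (x * y) ≤ x * x + y * y
  swapped y≤x = subst₂ _≤_ (cong (2 *_) (*-comm y x)) (+-comm (y * y) (x * x)) (ordered y≤x)

sum² : ∀ {m n} → (Fin m → Fin n → ℕ) → ℕ
sum² f = sum (λ i → sum (f i))

module _ {m n : ℕ} where

  sum²-cong : {f g : Fin m → Fin n → ℕ} → (∀ i j → f i j ≡ g i j) → sum² f ≡ sum² g
  sum²-cong f≡g = sum-cong-≗ (λ i → sum-cong-≗ (f≡g i))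

  sum²-mono-≤ : {f g : Fin m → Fin n → ℕ} → (∀ i j → f i j ≤ g i j) → sum² f ≤ sum² g
  sum²-mono-≤ f≤g = sum-mono-≤ (λ i → sum-mono-≤ (f≤g i))

  sum²-distrib-+ : (f g : Fin m → Fin n → ℕ) →
                   sum² (λ i j → f i j + g i j) ≡ sum² f + sum² g
  sum²-distrib-+ f g = trans (sum-cong-≗ (λ i → ∑-distrib-+ (f i) (g i)))
                             (∑-distrib-+ (λ i → sum (f i)) (λ i → sum (g i)))

  *-distribˡ-sum² : ∀ x (f : Fin m → Fin n → ℕ) → x * sum² f ≡ sum² (λ i j → x * f i j)
  *-distribˡ-sum² x f = trans (*-distribˡ-sum x (λ i → sum (f i)))
                              (sum-cong-≗ (λ i → *-distribˡ-sum x (f i)))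

  *-distribʳ-sum² : ∀ x (f : Fin m → Fin n → ℕ) → sum² f * x ≡ sum² (λ i j → f i j * x)
  *-distribʳ-sum² x f = trans (*-distribʳ-sum x (λ i → sum (f i)))
                              (sum-cong-≗ (λ i → *-distribʳ-sum x (f i)))

  sum*sum : (f : Fin m → ℕ) (g : Fin n → ℕ) → sum f * sum g ≡ sum² (λ i j → f i * g j)
  sum*sum f g = trans (*-distribʳ-sum (sum g) f) (sum-cong-≗ (λ i → *-distribˡ-sum (f i) g))

  sum-sum²-comm : ∀ {k} (f : Fin k → Fin m → Fin n → ℕ) →
                  sum (λ y → sum² (f y)) ≡ sum² (λ i j → sum (λ y → f y i j))
  sum-sum²-comm f = trans (∑-comm (λ y i → sum (f y i))) (sum-cong-≗ (λ i → ∑-comm (λ y j → f y i j)))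

cauchy-schwarz : ∀ {n} (a b : Fin n → ℕ) →
                 sum (λ i → a i * b i) * sum (λ i → a i * b i) ≤
                 sum (λ i → a i * a i) * sum (λ i → b i * b i)
cauchy-schwarz a b = *-cancelˡ-≤ 2 (begin
  2 * (sum ab * sum ab)                               ≡⟨ cong (2 *_) (sum*sum ab ab) ⟩
  2 * sum² (λ i j → ab i * ab j)                      ≡⟨ *-distribˡ-sum² 2 (λ i j → ab i * ab j) ⟩
  sum² (λ i j → 2 * (ab i * ab j))                    ≡⟨ sum²-cong (λ i j → cong (2 *_) (regroup (a i) (b i) (a j) (b j))) ⟩
  sum² (λ i j → 2 * (x i j * x j i))                  ≤⟨ sum²-mono-≤ (λ i j → 2xy≤x²+y² (x i j) (x j i)) ⟩
  sum² (λ i j → x i j * x i j + x j i * x j i)        ≡⟨ sum²-distrib-+ (λ i j → x i j * x i j) (λ i j → x j i * x j i) ⟩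
  X + sum² (λ i j → x j i * x j i)                    ≡⟨ cong (X +_) (∑-comm (λ i j → x j i * x j i)) ⟩
  X + X                                               ≡⟨ cong (λ t → t + t) X≡T ⟩
  T + T                                               ≡⟨ cong (T +_) (sym (+-identityʳ T)) ⟩
  2 * T                                               ∎)
  where
  open ≤-Reasoning
  ab : Fin _ → ℕ
  ab i = a i * b i
  x : Fin _ → Fin _ → ℕ
  x i j = a i * b j
  X T : ℕ
  X = sum² (λ i j → x i j * x i j)
  T = sum (λ i → a i * a i) * sum (λ i → b i * b i)
  regroup : ∀ p q r s → (p * q) * (r * s) ≡ (p * s) * (r * q)
  regroup = solve-∀
  square-split : ∀ p q → (p * q) * (p * q) ≡ (p * p) * (q * q)
  square-split = solve-∀
  X≡T : X ≡ T
  X≡T = trans (sum²-cong (λ i j → square-split (a i) (b j))) (sym (sum*sum (λ i → a i * a i) (λ j → b j * b j)))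

-- Counting with indicators

𝟙 : Bool → ℕ
𝟙 true  = 1
𝟙 false = 0

𝟙-∧ : ∀ x y → 𝟙 (x ∧ y) ≡ 𝟙 x * 𝟙 y
𝟙-∧ true  y = sym (+-identityʳ (𝟙 y))
𝟙-∧ false y = refl

𝟙-idem : ∀ x → 𝟙 x * 𝟙 x ≡ 𝟙 x
𝟙-idem true  = refl
𝟙-idem false = refl

𝟙-not : ∀ x → 𝟙 (not x) + 𝟙 x ≡ 1
𝟙-not true  = refl
𝟙-not false = refl

sum-δ : ∀ {n} (x : Fin n) (f : Fin n → ℕ) → sum (λ y → 𝟙 (does (x ≟ y)) * f y) ≡ f x
sum-δ {suc n} zero f = trans (cong₂ _+_ (+-identityʳ (f zero)) (sum-replicate-zero n)) (+-identityʳ (f zero))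
sum-δ (suc x) f = sum-δ x (f ∘ suc)

∣tabulate∣ : ∀ {n} (f : Fin n → Bool) → ∣ tabulate f ∣ ≡ sum (𝟙 ∘ f)
∣tabulate∣ {zero}  f = refl
∣tabulate∣ {suc n} f with f zero
... | true  = cong suc (∣tabulate∣ (f ∘ suc))
... | false = ∣tabulate∣ (f ∘ suc)

∣p∣≡sum : ∀ {n} (p : Subset n) → ∣ p ∣ ≡ sum (λ i → 𝟙 (does (i ∈? p)))
∣p∣≡sum []            = refl
∣p∣≡sum (inside  ∷ p) = cong suc (∣p∣≡sum p)
∣p∣≡sum (outside ∷ p) = ∣p∣≡sum p

length-filter-tabulate : ∀ {a p} {A : Set a} {P : Pred A p} (P? : Decidable P) {n} (f : Fin n → A) →
                         length (filter P? (List.tabulate f)) ≡ sum (λ i → 𝟙 (does (P? (f i))))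
length-filter-tabulate P? {zero}  f = refl
length-filter-tabulate P? {suc n} f with does (P? (f zero))
... | true  = cong suc (length-filter-tabulate P? (f ∘ suc))
... | false = length-filter-tabulate P? (f ∘ suc)

-- Finite sets

injective⇒surjective : ∀ {n} (f : Fin n → Fin n) → (∀ {i j} → f i ≡ f j → i ≡ j) →
                       ∀ y → ∃ λ x → f x ≡ y
injective⇒surjective {suc m} f f-inj y with any? (λ x → f x ≟ y)
... | yes hit  = hit
... | no  miss = contradiction (pigeonhole (n<1+n m) (λ x → punchOut (y≢f x))) no-collision
  where
  y≢f : ∀ x → y ≢ f x
  y≢f x y≡fx = miss (x , sym y≡fx)
  no-collision : ¬ ∃₂ λ i j → i <ᶠ j × punchOut (y≢f i) ≡ punchOut (y≢f j)
  no-collision (i , j , i<j , eq) = <ᶠ⇒≢ i<j (f-inj (punchOut-injective (y≢f i) (y≢f j) eq))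

module _ {n ℓ} {P : Pred (Fin n) ℓ} (P? : Decidable P) where

  toSubset : Subset n
  toSubset = tabulate (does ∘ P?)

  ∈-toSubset⁺ : ∀ {x} → P x → x ∈ toSubset
  ∈-toSubset⁺ {x} px = lookup⇒[]= x toSubset (trans (lookup∘tabulate (does ∘ P?) x) (dec-true (P? x) px))

  ∈-toSubset⁻ : ∀ {x} → x ∈ toSubset → P x
  ∈-toSubset⁻ {x} x∈ with P? x | trans (sym (lookup∘tabulate (does ∘ P?) x)) ([]=⇒lookup x∈)
  ... | yes px | _  = px
  ... | no  _  | ()

nonempty⇒∣p∣≥1 : ∀ {n} {p : Subset n} → Nonempty p → 1 ≤ ∣ p ∣
nonempty⇒∣p∣≥1 {p = p} (x , x∈p) = subst (_≤ ∣ p ∣) (∣⁅x⁆∣≡1 x)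
  (p⊆q⇒∣p∣≤∣q∣ (λ y∈⁅x⁆ → subst (_∈ p) (sym (x∈⁅y⁆⇒x≡y x y∈⁅x⁆)) x∈p))

module _ {n} (step : Subset n → Subset n) (inflationary : ∀ S → S ⊆ step S) where

  closure : Subset n → Subset n
  closure S = fold S step (suc n)

  ⊆-closure : ∀ S → S ⊆ closure S
  ⊆-closure S = go (suc n)
    where
    go : ∀ k → S ⊆ fold S step k
    go zero    x∈S = x∈S
    go (suc k) x∈S = inflationary _ (go k x∈S)

  private
    stays-closed : ∀ {S} → step S ⊆ S → step (step S) ⊆ step S
    stays-closed {S} closed rewrite ⊆-antisym closed (inflationary S) = closed

    ⊄⇒⊇ : ∀ {S} → ¬ (S ⊂ step S) → step S ⊆ S
    ⊄⇒⊇ {S} ¬grown {x} x∈stepS with x ∈? S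
    ... | yes x∈S = x∈S
    ... | no  x∉S = contradiction ((λ {y} → inflationary S {y}) , x , x∈stepS , x∉S) ¬grown

    closed-or-grown : ∀ S k → step (fold S step k) ⊆ fold S step k ⊎ k ≤ ∣ fold S step k ∣
    closed-or-grown S zero = inj₂ z≤n
    closed-or-grown S (suc k) with closed-or-grown S k
    ... | inj₁ closed = inj₁ (stays-closed closed)
    ... | inj₂ k≤∣Sₖ∣ with fold S step k ⊂? step (fold S step k)
    ...   | yes grown = inj₂ (≤-trans (s≤s k≤∣Sₖ∣) (p⊂q⇒∣p∣<∣q∣ grown))
    ...   | no ¬grown = inj₁ (stays-closed (⊄⇒⊇ ¬grown))

  closure-closed : ∀ S → step (closure S) ⊆ closure S
  closure-closed S with closed-or-grown S (suc n)
  ... | inj₁ closed = closed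
  ... | inj₂ n<∣Sₙ∣ = contradiction (∣p∣≤n (closure S)) (<⇒≱ n<∣Sₙ∣)

module Residues (q : ℕ) .{{_ : NonZero q}} where

  toℕ-mod : ∀ m → toℕ (m mod q) ≡ m % q
  toℕ-mod m = toℕ-fromℕ< (m%n<n m q)

  mod-cong : ∀ {m n} → m % q ≡ n % q → m mod q ≡ n mod q
  mod-cong {m} {n} eq = toℕ-injective (trans (toℕ-mod m) (trans eq (sym (toℕ-mod n))))

  toℕ-mod-toℕ : ∀ (x : Fin q) → toℕ x mod q ≡ x
  toℕ-mod-toℕ x = toℕ-injective (trans (toℕ-mod (toℕ x)) (m<n⇒m%n≡m (toℕ<n x)))

  %-absorbˡ-* : ∀ m n → (m % q * n) % q ≡ (m * n) % q
  %-absorbˡ-* m n = begin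
    (m % q * n) % q            ≡⟨ %-distribˡ-* (m % q) n q ⟩
    (m % q % q * (n % q)) % q  ≡⟨ cong (λ r → (r * (n % q)) % q) (m%n%n≡m%n m q) ⟩
    (m % q * (n % q)) % q      ≡⟨ %-distribˡ-* m n q ⟨
    (m * n) % q                ∎
    where open ≡-Reasoning

  %-absorbʳ-* : ∀ m n → (m * (n % q)) % q ≡ (m * n) % q
  %-absorbʳ-* m n = begin
    (m * (n % q)) % q  ≡⟨ cong (_% q) (*-comm m (n % q)) ⟩
    (n % q * m) % q    ≡⟨ %-absorbˡ-* n m ⟩
    (n * m) % q        ≡⟨ cong (_% q) (*-comm n m) ⟩
    (m * n) % q        ∎
    where open ≡-Reasoning

  ·-comm : ∀ (x y : Fin q) → x · y ≡ y · x
  ·-comm x y = cong (_mod q) (*-comm (toℕ x) (toℕ y))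

  ·-assoc : ∀ (x y z : Fin q) → (x · y) · z ≡ x · (y · z)
  ·-assoc x y z = mod-cong (begin
    (toℕ (x · y) * toℕ z) % q        ≡⟨ cong (λ r → (r * toℕ z) % q) (toℕ-mod (toℕ x * toℕ y)) ⟩
    ((toℕ x * toℕ y) % q * toℕ z) % q ≡⟨ %-absorbˡ-* (toℕ x * toℕ y) (toℕ z) ⟩
    (toℕ x * toℕ y * toℕ z) % q       ≡⟨ cong (_% q) (*-assoc (toℕ x) (toℕ y) (toℕ z)) ⟩
    (toℕ x * (toℕ y * toℕ z)) % q     ≡⟨ %-absorbʳ-* (toℕ x) (toℕ y * toℕ z) ⟨
    (toℕ x * ((toℕ y * toℕ z) % q)) % q ≡⟨ cong (λ r → (toℕ x * r) % q) (toℕ-mod (toℕ y * toℕ z)) ⟨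
    (toℕ x * toℕ (y · z)) % q         ∎)
    where open ≡-Reasoning

  ·-identityˡ : ∀ (x : Fin q) → oneF · x ≡ x
  ·-identityˡ x = trans (mod-cong (begin
    (toℕ (oneF {q}) * toℕ x) % q ≡⟨ cong (λ r → (r * toℕ x) % q) (toℕ-mod 1) ⟩
    (1 % q * toℕ x) % q          ≡⟨ %-absorbˡ-* 1 (toℕ x) ⟩
    (1 * toℕ x) % q              ≡⟨ cong (_% q) (*-identityˡ (toℕ x)) ⟩
    toℕ x % q                    ∎)) (toℕ-mod-toℕ x)
    where open ≡-Reasoning

  ·-identityʳ : ∀ (x : Fin q) → x · oneF ≡ x
  ·-identityʳ x = trans (·-comm x oneF) (·-identityˡ x)

  toℕ-·-zeroʳ : ∀ (x : Fin q) {g} → toℕ g ≡ 0 → toℕ (x · g) ≡ 0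
  toℕ-·-zeroʳ x {g} g≡0 = begin
    toℕ (x · g)          ≡⟨ toℕ-mod (toℕ x * toℕ g) ⟩
    (toℕ x * toℕ g) % q  ≡⟨ cong (λ r → (toℕ x * r) % q) g≡0 ⟩
    (toℕ x * 0) % q      ≡⟨ cong (_% q) (*-zeroʳ (toℕ x)) ⟩
    (0 * q) % q          ≡⟨ m*n%n≡0 0 q ⟩
    0                    ∎
    where open ≡-Reasoning

  %≡⇒∣∸ : ∀ m n → m % q ≡ n % q → q ∣ n ∸ m
  %≡⇒∣∸ m n eq = divides (n / q ∸ m / q) (begin
    n ∸ m                                    ≡⟨ cong₂ _∸_ (m≡m%n+[m/n]*n n q) (m≡m%n+[m/n]*n m q) ⟩
    (n % q + n / q * q) ∸ (m % q + m / q * q) ≡⟨ cong (λ r → (n % q + n / q * q) ∸ (r + m / q * q)) eq ⟩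
    (n % q + n / q * q) ∸ (n % q + m / q * q) ≡⟨ [m+n]∸[m+o]≡n∸o (n % q) _ _ ⟩
    n / q * q ∸ m / q * q                    ≡⟨ *-distribʳ-∸ q (n / q) (m / q) ⟨
    (n / q ∸ m / q) * q                      ∎)
    where open ≡-Reasoning

  ∣∧<⇒≡0 : ∀ {m} → q ∣ m → m < q → m ≡ 0
  ∣∧<⇒≡0 {zero}  _   _   = refl
  ∣∧<⇒≡0 {suc m} q∣m m<q = contradiction q∣m (>⇒∤ m<q)

module PrimeField (q : ℕ) .{{_ : NonZero q}} (q-prime : Prime q) where

  open Residues q

  private
    ·-cancelˡ-≤ : ∀ {a} b c → toℕ a ≢ 0 → a · b ≡ a · c → toℕ c ≤ toℕ b
    ·-cancelˡ-≤ {a} b c a≢0 ab≡ac = m∸n≡0⇒m≤n (∣∧<⇒≡0 q∣c∸b c∸b<q)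
      where
      q∣a[c∸b] : q ∣ toℕ a * (toℕ c ∸ toℕ b)
      q∣a[c∸b] = subst (q ∣_) (sym (*-distribˡ-∸ (toℕ a) (toℕ c) (toℕ b)))
        (%≡⇒∣∸ (toℕ a * toℕ b) (toℕ a * toℕ c)
          (trans (sym (toℕ-mod _)) (trans (cong toℕ ab≡ac) (toℕ-mod _))))
      q∣c∸b : q ∣ toℕ c ∸ toℕ b
      q∣c∸b = coprime-divisor (prime⇒coprime q-prime {{≢-nonZero a≢0}} (toℕ<n a)) q∣a[c∸b]
      c∸b<q : toℕ c ∸ toℕ b < q
      c∸b<q = ≤-<-trans (m∸n≤m (toℕ c) (toℕ b)) (toℕ<n c)

  ·-cancelˡ : ∀ {a b c} → toℕ a ≢ 0 → a · b ≡ a · c → b ≡ c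
  ·-cancelˡ {b = b} {c} a≢0 ab≡ac =
    toℕ-injective (≤-antisym (·-cancelˡ-≤ c b a≢0 (sym ab≡ac)) (·-cancelˡ-≤ b c a≢0 ab≡ac))

  ·-divide : ∀ {c} → toℕ c ≢ 0 → ∀ a → ∃ λ s → c · s ≡ a
  ·-divide {c} c≢0 = injective⇒surjective (c ·_) (·-cancelˡ c≢0)

module Generated (q : ℕ) .{{_ : NonZero q}} (H : Fin q → Set) where

  open Residues q

  Gen-· : ∀ {g g′} → Gen H g → Gen H g′ → Gen H (g · g′)
  Gen-· {g′ = g′} gen-one gg′ = subst (Gen H) (sym (·-identityˡ g′)) gg′
  Gen-· {g′ = g′} (gen-mul {h} {g} hH gg) gg′ =
    subst (Gen H) (sym (·-assoc h g g′)) (gen-mul hH (Gen-· gg gg′))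
  Gen-· {g′ = g′} (gen-div {h} {x = x} hH gg hx≡g) gg′ =
    gen-div hH (Gen-· gg gg′) (trans (sym (·-assoc h x g′)) (cong (_· g′) hx≡g))

  Gen-÷ : ∀ {g x} → Gen H g → Gen H (g · x) → Gen H x
  Gen-÷ {x = x} gen-one g1x = subst (Gen H) (·-identityˡ x) g1x
  Gen-÷ {x = x} (gen-mul {h} {g} hH gg) ghx =
    Gen-÷ gg (gen-div hH ghx (sym (·-assoc h g x)))
  Gen-÷ {x = x} (gen-div {h} {g} {y} hH gg hy≡g) gyx =
    Gen-÷ gg (subst (Gen H) (trans (sym (·-assoc h y x)) (cong (_· x) hy≡g)) (gen-mul hH gyx))

  module _ (H? : Decidable H) where

    Step : Subset q → Fin q → Set
    Step S x = x ∈ S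
             ⊎ (∃ λ h → H h × ∃ λ y → y ∈ S × h · y ≡ x)
             ⊎ (∃ λ h → H h × h · x ∈ S)

    Step? : ∀ S → Decidable (Step S)
    Step? S x = x ∈? S
      ⊎-dec any? (λ h → H? h ×-dec any? (λ y → y ∈? S ×-dec h · y ≟ x))
      ⊎-dec any? (λ h → H? h ×-dec h · x ∈? S)

    step : Subset q → Subset q
    step S = toSubset (Step? S)

    inflationary : ∀ S → S ⊆ step S
    inflationary S = ∈-toSubset⁺ (Step? S) ∘ inj₁

    generated : Subset q
    generated = closure step inflationary ⁅ oneF ⁆

    closed : ∀ {x} → Step generated x → x ∈ generated
    closed = closure-closed step inflationary ⁅ oneF ⁆ ∘ ∈-toSubset⁺ (Step? generated)

    generated-sound : ∀ {x} → x ∈ generated → Gen H x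
    generated-sound = stage (suc q)
      where
      stage : ∀ k {x} → x ∈ fold ⁅ oneF ⁆ step k → Gen H x
      stage zero x∈⁅1⁆ rewrite x∈⁅y⁆⇒x≡y oneF x∈⁅1⁆ = gen-one
      stage (suc k) x∈ with ∈-toSubset⁻ (Step? _) x∈
      ... | inj₁ x∈Sₖ                         = stage k x∈Sₖ
      ... | inj₂ (inj₁ (h , hH , y , y∈ , refl)) = gen-mul hH (stage k y∈)
      ... | inj₂ (inj₂ (h , hH , hx∈))          = gen-div hH (stage k hx∈) refl

    generated-complete : ∀ {x} → Gen H x → x ∈ generated
    generated-complete gen-one = ⊆-closure step inflationary ⁅ oneF ⁆ (x∈⁅x⁆ oneF)
    generated-complete (gen-mul hH gg) =
      closed (inj₂ (inj₁ (_ , hH , _ , generated-complete gg , refl)))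
    generated-complete (gen-div hH gg refl) =
      closed (inj₂ (inj₂ (_ , hH , generated-complete gg)))

    -- Opaque so that with-abstractions over goals mentioning Gen? do not normalise the closure.
    opaque
      Gen? : Decidable (Gen H)
      Gen? x = map′ generated-sound generated-complete (x ∈? generated)

module Cosets (q : ℕ) .{{_ : NonZero q}} (q-prime : Prime q) (H : Fin q → Set) where

  open Residues q
  open PrimeField q q-prime
  open Generated q H

  infix 4 _∼_
  _∼_ : Fin q → Fin q → Set
  a ∼ x = inCoset (Gen H) a x

  ∼-trans : ∀ {a x y} → a ∼ x → x ∼ y → a ∼ y
  ∼-trans {a} (g , gg , refl) (g′ , gg′ , refl) = g · g′ , Gen-· gg gg′ , ·-assoc a g g′

  ∼-sym : ∀ {a x} → toℕ x ≢ 0 → a ∼ x → x ∼ a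
  ∼-sym {a} x≢0 (g , gg , refl) with g⁻¹ , gg⁻¹≡1 ← ·-divide (x≢0 ∘ toℕ-·-zeroʳ a) oneF =
    g⁻¹ , Gen-÷ gg (subst (Gen H) (sym gg⁻¹≡1) gen-one) , sym (begin
      (a · g) · g⁻¹  ≡⟨ ·-assoc a g g⁻¹ ⟩
      a · (g · g⁻¹)  ≡⟨ cong (a ·_) gg⁻¹≡1 ⟩
      a · oneF       ≡⟨ ·-identityʳ a ⟩
      a              ∎)
    where open ≡-Reasoning

  ∼-by-generator : ∀ {c s a} → c · s ≡ a → H s → c ∼ a
  ∼-by-generator {s = s} cs≡a hs =
    s , subst (Gen H) (·-identityʳ s) (gen-mul hs gen-one) , sym cs≡a

  ∼-exchange : ∀ {a b c d} → toℕ a ≢ 0 → a · b ≡ d · c → a ∼ d → c ∼ b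
  ∼-exchange {a} {b} {c} a≢0 ab≡dc (g , gg , refl) =
    g , gg , trans (·-cancelˡ a≢0 (trans ab≡dc (·-assoc a g c))) (·-comm g c)

counting-contradiction : ∀ {n D S} → 1 ≤ n → n * n ≡ D + S → 3 * S + n ≤ n * n →
                         5 * (D * D) ≤ 2 * (n * n * D) → ⊥
counting-contradiction {n} {D} {S} 1≤n n²≡D+S 3S+n≤n² 5D²≤2n²D =
  contradiction (+-cancelˡ-≤ (5 * D) n 0 5D+n≤5D) (<⇒≱ 1≤n)
  where
  open ≤-Reasoning
  S+[2S+n]≡3S+n : ∀ S n → S + (2 * S + n) ≡ 3 * S + n
  S+[2S+n]≡3S+n = solve-∀
  D*[5D]≡5*[D*D] : ∀ D → D * (5 * D) ≡ 5 * (D * D)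
  D*[5D]≡5*[D*D] = solve-∀
  2*[n*n*D]≡D*[2*[n*n]] : ∀ n D → 2 * (n * n * D) ≡ D * (2 * (n * n))
  2*[n*n*D]≡D*[2*[n*n]] = solve-∀
  2[D+S]+n≡2D+[2S+n] : ∀ D S n → 2 * (D + S) + n ≡ 2 * D + (2 * S + n)
  2[D+S]+n≡2D+[2S+n] = solve-∀
  2D+D≡3D : ∀ D → 2 * D + D ≡ 3 * D
  2D+D≡3D = solve-∀
  2S+n≤D : 2 * S + n ≤ D
  2S+n≤D = +-cancelˡ-≤ S (2 * S + n) D (begin
    S + (2 * S + n) ≡⟨ S+[2S+n]≡3S+n S n ⟩
    3 * S + n       ≤⟨ 3S+n≤n² ⟩
    n * n           ≡⟨ n²≡D+S ⟩
    D + S           ≡⟨ +-comm D S ⟩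
    S + D           ∎)
  instance
    D≢0 : NonZero D
    D≢0 = >-nonZero (≤-trans 1≤n (≤-trans (m≤n+m n (2 * S)) 2S+n≤D))
  5D≤2n² : 5 * D ≤ 2 * (n * n)
  5D≤2n² = *-cancelˡ-≤ D (begin
    D * (5 * D)         ≡⟨ D*[5D]≡5*[D*D] D ⟩
    5 * (D * D)         ≤⟨ 5D²≤2n²D ⟩
    2 * (n * n * D)     ≡⟨ 2*[n*n*D]≡D*[2*[n*n]] n D ⟩
    D * (2 * (n * n))   ∎)
  5D+n≤5D : 5 * D + n ≤ 5 * D + 0
  5D+n≤5D = begin
    5 * D + n            ≤⟨ +-monoˡ-≤ n 5D≤2n² ⟩
    2 * (n * n) + n      ≡⟨ cong (λ m → 2 * m + n) n²≡D+S ⟩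
    2 * (D + S) + n      ≡⟨ 2[D+S]+n≡2D+[2S+n] D S n ⟩
    2 * D + (2 * S + n)  ≤⟨ +-monoʳ-≤ (2 * D) 2S+n≤D ⟩
    2 * D + D            ≡⟨ 2D+D≡3D D ⟩
    3 * D                ≤⟨ *-monoˡ-≤ D (m≤m+n 3 2) ⟩
    5 * D                ≡⟨ +-identityʳ (5 * D) ⟨
    5 * D + 0            ∎

module Counting (q : ℕ) .{{_ : NonZero q}} (q-prime : Prime q)
                (A : Subset q) (A⊆F* : ∀ x → x ∈ A → toℕ x ≢ 0) where

  open Residues q
  open PrimeField q q-prime
  open Generated q (inH A)
  open Cosets q q-prime (inH A)

  inH? : Decidable (inH A)
  inH? s = ∣ A ∣ * ∣ A ∣ ≤? 5 * (ratioCount A s * ∣ prodSet A ∣)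

  infix 4 _∼?_
  _∼?_ : ∀ a x → Dec (a ∼ x)
  a ∼? x = any? (λ g → Gen? inH? g ×-dec x ≟ a · g)

  A∩coset? : ∀ a x → Dec (x ∈ A × a ∼ x)
  A∩coset? a x = x ∈? A ×-dec a ∼? x

  cosetCount : Fin q → ℕ
  cosetCount a = sum (λ x → 𝟙 (does (A∩coset? a x)))

  n N : ℕ
  n = ∣ A ∣
  N = ∣ prodSet A ∣

  χ : Fin q → ℕ
  χ a = 𝟙 (does (a ∈? A))

  δ : Fin q → Fin q → ℕ
  δ x y = 𝟙 (does (x ≟ y))

  δ-cong : ∀ {x y x′ y′} → (x ≡ y ⇔ x′ ≡ y′) → δ x y ≡ δ x′ y′
  δ-cong {x} {y} {x′} {y′} iff = cong 𝟙 (does-⇔ iff (x ≟ y) (x′ ≟ y′))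

  apart same : Fin q → Fin q → ℕ
  apart a c = χ a * χ c * 𝟙 (not (does (a ∼? c)))
  same  a c = χ a * χ c * 𝟙 (does (a ∼? c))

  collisions : Fin q → Fin q → ℕ
  collisions a c = sum² (λ b d → χ b * χ d * δ (c · d) (a · b))

  apartPairs samePairs apartCollisions : ℕ
  apartPairs      = sum² apart
  samePairs       = sum² same
  apartCollisions = sum² (λ a c → apart a c * collisions a c)

  n≡sum-χ : n ≡ sum χ
  n≡sum-χ = ∣p∣≡sum A

  n*n≡apart+same : n * n ≡ apartPairs + samePairs
  n*n≡apart+same = begin
    n * n                                 ≡⟨ cong₂ _*_ n≡sum-χ n≡sum-χ ⟩
    sum χ * sum χ                         ≡⟨ sum*sum χ χ ⟩
    sum² (λ a c → χ a * χ c)              ≡⟨ sum²-cong split ⟩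
    sum² (λ a c → apart a c + same a c)   ≡⟨ sum²-distrib-+ apart same ⟩
    apartPairs + samePairs                ∎
    where
    open ≡-Reasoning
    split : ∀ a c → χ a * χ c ≡ apart a c + same a c
    split a c = begin
      χ a * χ c                                                  ≡⟨ *-identityʳ (χ a * χ c) ⟨
      χ a * χ c * 1                                              ≡⟨ cong (χ a * χ c *_) (𝟙-not (does (a ∼? c))) ⟨
      χ a * χ c * (𝟙 (not (does (a ∼? c))) + 𝟙 (does (a ∼? c)))  ≡⟨ *-distribˡ-+ (χ a * χ c) _ _ ⟩
      apart a c + same a c                                       ∎

  ratioCount≡sum² : ∀ s → ratioCount A s ≡ sum² (λ a b → χ a * (χ b * δ (s · b) a))
  ratioCount≡sum² s = sum-cong-≗ {q} row
    where
    row : ∀ a → ∣ tabulate (λ b → does (a ∈? A ×-dec (b ∈? A ×-dec s · b ≟ a))) ∣ ≡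
                sum (λ b → χ a * (χ b * δ (s · b) a))
    row a = trans (∣tabulate∣ (λ b → does (a ∈? A ×-dec (b ∈? A ×-dec s · b ≟ a))))
                  (sum-cong-≗ {q} (λ b → trans (𝟙-∧ (does (a ∈? A)) _) (cong (χ a *_) (𝟙-∧ (does (b ∈? A)) _))))

  collisions≡ratioCount : ∀ {a c s} → toℕ c ≢ 0 → c · s ≡ a → collisions a c ≡ ratioCount A s
  collisions≡ratioCount {a} {c} {s} c≢0 cs≡a = begin
    collisions a c                                 ≡⟨ sum²-cong reindex ⟩
    sum² (λ b d → χ d * (χ b * δ (s · b) d))       ≡⟨ ∑-comm (λ b d → χ d * (χ b * δ (s · b) d)) ⟩
    sum² (λ d b → χ d * (χ b * δ (s · b) d))       ≡⟨ ratioCount≡sum² s ⟨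
    ratioCount A s                                 ∎
    where
    open ≡-Reasoning
    rearrange : ∀ x y z → x * y * z ≡ y * (x * z)
    rearrange = solve-∀
    c[sb]≡ab : ∀ b → c · (s · b) ≡ a · b
    c[sb]≡ab b = trans (sym (·-assoc c s b)) (cong (_· b) cs≡a)
    cancel : ∀ {b d} → c · d ≡ a · b → s · b ≡ d
    cancel {b} cd≡ab = ·-cancelˡ c≢0 (trans (c[sb]≡ab b) (sym cd≡ab))
    expand : ∀ {b d} → s · b ≡ d → c · d ≡ a · b
    expand {b} refl = c[sb]≡ab b
    reindex : ∀ b d → χ b * χ d * δ (c · d) (a · b) ≡ χ d * (χ b * δ (s · b) d)
    reindex b d = trans (rearrange (χ b) (χ d) _) (cong (λ t → χ d * (χ b * t)) (δ-cong (mk⇔ cancel expand)))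

  collisions-small : ∀ {a c} → a ∈ A → c ∈ A → ¬ a ∼ c → 5 * N * collisions a c ≤ n * n
  collisions-small {a} {c} a∈A c∈A a≁c with s , cs≡a ← ·-divide (A⊆F* c c∈A) a =
    ≤-trans (≤-reflexive (begin
      5 * N * collisions a c   ≡⟨ cong (5 * N *_) (collisions≡ratioCount (A⊆F* c c∈A) cs≡a) ⟩
      5 * N * ratioCount A s   ≡⟨ *-assoc 5 N _ ⟩
      5 * (N * ratioCount A s) ≡⟨ cong (5 *_) (*-comm N _) ⟩
      5 * (ratioCount A s * N) ∎))
    (<⇒≤ (≰⇒> λ (s∈H : inH A s) →
      a≁c (∼-sym (A⊆F* a a∈A) (∼-by-generator {c} {s} cs≡a s∈H))))
    where open ≡-Reasoning

  apart-weighted : ∀ a c {x y} → (a ∈ A → c ∈ A → ¬ a ∼ c → x ≤ y) → apart a c * x ≤ apart a c * y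
  apart-weighted a c x≤y with a ∈? A | c ∈? A | a ∼? c
  ... | yes a∈A | yes c∈A | no a≁c = *-monoʳ-≤ 1 (x≤y a∈A c∈A a≁c)
  ... | no _    | _       | _      = z≤n
  ... | yes _   | no _    | _      = z≤n
  ... | yes _   | yes _   | yes _  = z≤n

  apart-collisions-bound : 5 * N * apartCollisions ≤ n * n * apartPairs
  apart-collisions-bound = begin
    5 * N * apartCollisions                             ≡⟨ *-distribˡ-sum² (5 * N) (λ a c → apart a c * collisions a c) ⟩
    sum² (λ a c → 5 * N * (apart a c * collisions a c))  ≡⟨ sum²-cong (λ a c → x*[y*z]≡y*[x*z] (5 * N) (apart a c) _) ⟩
    sum² (λ a c → apart a c * (5 * N * collisions a c))  ≤⟨ sum²-mono-≤ (λ a c → apart-weighted a c collisions-small) ⟩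
    sum² (λ a c → apart a c * (n * n))                   ≡⟨ sum²-cong (λ a c → *-comm (apart a c) (n * n)) ⟩
    sum² (λ a c → n * n * apart a c)                     ≡⟨ *-distribˡ-sum² (n * n) apart ⟨
    n * n * apartPairs                                   ∎
    where
    open ≤-Reasoning
    x*[y*z]≡y*[x*z] : ∀ x y z → x * (y * z) ≡ y * (x * z)
    x*[y*z]≡y*[x*z] = solve-∀

  isProduct? : ∀ y → Dec (∃ λ a → ∃ λ b → a ∈ A × b ∈ A × a · b ≡ y)
  isProduct? y = any? (λ a → any? (λ b → a ∈? A ×-dec (b ∈? A ×-dec a · b ≟ y)))

  isProduct : Fin q → ℕ
  isProduct y = 𝟙 (does (isProduct? y))

  apartProducts : Fin q → ℕ
  apartProducts y = sum² (λ a b → δ (a · b) y * apart a b)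

  apartEnergy : ℕ
  apartEnergy = sum (λ y → apartProducts y * apartProducts y)

  sum-apartProducts : sum apartProducts ≡ apartPairs
  sum-apartProducts = trans (sum-sum²-comm (λ y a b → δ (a · b) y * apart a b))
                            (sum²-cong (λ a b → sum-δ (a · b) (λ _ → apart a b)))

  apartProducts-support : ∀ y → apartProducts y ≡ isProduct y * apartProducts y
  apartProducts-support y =
    trans (sum²-cong pointwise) (sym (*-distribˡ-sum² (isProduct y) (λ a b → δ (a · b) y * apart a b)))
    where
    pointwise : ∀ a b → δ (a · b) y * apart a b ≡ isProduct y * (δ (a · b) y * apart a b)
    pointwise a b with isProduct? y
    ... | yes _ = sym (+-identityʳ _)
    ... | no ¬isProduct with a · b ≟ y | a ∈? A | b ∈? A
    ...   | yes ab≡y | yes a∈A | yes b∈A = contradiction (a , b , a∈A , b∈A , ab≡y) ¬isProduct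
    ...   | no _     | _       | _       = refl
    ...   | yes _    | no _    | _       = refl
    ...   | yes _    | yes _   | no _    = refl

  apartPairs²≤N*apartEnergy : apartPairs * apartPairs ≤ N * apartEnergy
  apartPairs²≤N*apartEnergy =
    subst₂ (λ u v → u * u ≤ v * apartEnergy) weighted-sum indicator-sum
      (cauchy-schwarz isProduct apartProducts)
    where
    weighted-sum : sum (λ y → isProduct y * apartProducts y) ≡ apartPairs
    weighted-sum = trans (sum-cong-≗ {q} (sym ∘ apartProducts-support)) sum-apartProducts
    indicator-sum : sum (λ y → isProduct y * isProduct y) ≡ N
    indicator-sum = trans (sum-cong-≗ {q} (λ y → 𝟙-idem (does (isProduct? y))))
                          (sym (∣tabulate∣ (does ∘ isProduct?)))

  crossing : Fin q → Fin q → Fin q → Fin q → ℕ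
  crossing a b c d = apart a c * (χ b * χ d * δ (c · d) (a · b))

  -- If a b = c d with a ≁ b, then a ≁ c or a ≁ d: if a ∼ d then c ∼ b, so a ∼ c would give a ∼ b.
  apartEnergy-summand≤crossing : ∀ a b c d → apart a b * (δ (c · d) (a · b) * apart c d) ≤
                                             crossing a b c d + crossing a b d c
  apartEnergy-summand≤crossing a b c d with a ∈? A | b ∈? A | a ∼? b
  ... | no _    | _       | _      = z≤n
  ... | yes _   | no _    | _      = z≤n
  ... | yes _   | yes _   | yes _  = z≤n
  ... | yes a∈A | yes b∈A | no a≁b with c · d ≟ a · b
  ...   | no _ = z≤n
  ...   | yes cd≡ab with c ∈? A | d ∈? A | c ∼? d
  ...     | no _    | _       | _      = z≤n
  ...     | yes _   | no _    | _      = z≤n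
  ...     | yes _   | yes _   | yes _  = z≤n
  ...     | yes c∈A | yes d∈A | no c≁d with a ∼? c
  ...       | no _ = s≤s z≤n
  ...       | yes a∼c with a ∼? d | d · c ≟ a · b
  ...         | yes a∼d | _        =
    contradiction (∼-trans {a} a∼c (∼-exchange {a} {b} {c} {d} (A⊆F* a a∈A) ab≡dc a∼d)) a≁b
    where
    ab≡dc : a · b ≡ d · c
    ab≡dc = sym (trans (·-comm d c) cd≡ab)
  ...         | no _    | yes _    = s≤s z≤n
  ...         | no _    | no dc≢ab = contradiction (trans (·-comm d c) cd≡ab) dc≢ab

  apartEnergy≡ : apartEnergy ≡ sum² (λ a b → sum² (λ c d → apart a b * (δ (c · d) (a · b) * apart c d)))
  apartEnergy≡ = begin
    sum (λ y → apartProducts y * apartProducts y)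
      ≡⟨ sum-cong-≗ {q} (λ y → *-distribʳ-sum² (apartProducts y) (λ a b → δ (a · b) y * apart a b)) ⟩
    sum (λ y → sum² (λ a b → δ (a · b) y * apart a b * apartProducts y))
      ≡⟨ sum-sum²-comm (λ y a b → δ (a · b) y * apart a b * apartProducts y) ⟩
    sum² (λ a b → sum (λ y → δ (a · b) y * apart a b * apartProducts y))
      ≡⟨ sum²-cong (λ a b → trans (sum-cong-≗ {q} (λ y → *-assoc (δ (a · b) y) (apart a b) (apartProducts y)))
                                  (sum-δ (a · b) (λ y → apart a b * apartProducts y))) ⟩
    sum² (λ a b → apart a b * apartProducts (a · b))
      ≡⟨ sum²-cong (λ a b → *-distribˡ-sum² (apart a b) (λ c d → δ (c · d) (a · b) * apart c d)) ⟩
    sum² (λ a b → sum² (λ c d → apart a b * (δ (c · d) (a · b) * apart c d))) ∎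
    where open ≡-Reasoning

  sum-crossing : sum² (λ a b → sum² (crossing a b)) ≡ apartCollisions
  sum-crossing = sum-cong-≗ {q} (λ a → trans (∑-comm (λ b c → sum (crossing a b c)))
    (sum-cong-≗ {q} (λ c → sym (*-distribˡ-sum² (apart a c) (λ b d → χ b * χ d * δ (c · d) (a · b))))))

  apartEnergy≤2*apartCollisions : apartEnergy ≤ apartCollisions + apartCollisions
  apartEnergy≤2*apartCollisions = begin
    apartEnergy
      ≡⟨ apartEnergy≡ ⟩
    sum² (λ a b → sum² (λ c d → apart a b * (δ (c · d) (a · b) * apart c d)))
      ≤⟨ sum²-mono-≤ (λ a b → sum²-mono-≤ (apartEnergy-summand≤crossing a b)) ⟩
    sum² (λ a b → sum² (λ c d → crossing a b c d + crossing a b d c))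
      ≡⟨ sum²-cong (λ a b → sum²-distrib-+ (crossing a b) (λ c d → crossing a b d c)) ⟩
    sum² (λ a b → sum² (crossing a b) + sum² (λ c d → crossing a b d c))
      ≡⟨ sum²-distrib-+ (λ a b → sum² (crossing a b)) (λ a b → sum² (λ c d → crossing a b d c)) ⟩
    sum² (λ a b → sum² (crossing a b)) + sum² (λ a b → sum² (λ c d → crossing a b d c))
      ≡⟨ cong (sum² (λ a b → sum² (crossing a b)) +_) (sum²-cong (λ a b → ∑-comm (λ c d → crossing a b d c))) ⟩
    sum² (λ a b → sum² (crossing a b)) + sum² (λ a b → sum² (crossing a b))
      ≡⟨ cong₂ _+_ sum-crossing sum-crossing ⟩
    apartCollisions + apartCollisions ∎
    where open ≤-Reasoning

  apartPairs-bound : 5 * (apartPairs * apartPairs) ≤ 2 * (n * n * apartPairs)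
  apartPairs-bound = begin
    5 * (apartPairs * apartPairs)                ≤⟨ *-monoʳ-≤ 5 apartPairs²≤N*apartEnergy ⟩
    5 * (N * apartEnergy)                        ≤⟨ *-monoʳ-≤ 5 (*-monoʳ-≤ N apartEnergy≤2*apartCollisions) ⟩
    5 * (N * (apartCollisions + apartCollisions)) ≡⟨ regroup N apartCollisions ⟩
    2 * (5 * N * apartCollisions)                ≤⟨ *-monoʳ-≤ 2 apart-collisions-bound ⟩
    2 * (n * n * apartPairs)                     ∎
    where
    open ≤-Reasoning
    regroup : ∀ N Q → 5 * (N * (Q + Q)) ≡ 2 * (5 * N * Q)
    regroup = solve-∀

  samePairs≡ : samePairs ≡ sum (λ a → χ a * cosetCount a)
  samePairs≡ = sum-cong-≗ {q} (λ a → trans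
    (sum-cong-≗ {q} (λ c → trans (*-assoc (χ a) (χ c) _) (cong (χ a *_) (sym (𝟙-∧ (does (c ∈? A)) (does (a ∼? c)))))))
    (sym (*-distribˡ-sum (χ a) (λ c → 𝟙 (does (A∩coset? a c))))))

  small-cosets⇒samePairs-bound : (∀ a → a ∈ A → 3 * cosetCount a < n) → 3 * samePairs + n ≤ n * n
  small-cosets⇒samePairs-bound small = begin
    3 * samePairs + n                               ≡⟨ cong₂ _+_ (cong (3 *_) samePairs≡) n≡sum-χ ⟩
    3 * sum (λ a → χ a * cosetCount a) + sum χ      ≡⟨ cong (_+ sum χ) (*-distribˡ-sum 3 (λ a → χ a * cosetCount a)) ⟩
    sum (λ a → 3 * (χ a * cosetCount a)) + sum χ    ≡⟨ ∑-distrib-+ (λ a → 3 * (χ a * cosetCount a)) χ ⟨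
    sum (λ a → 3 * (χ a * cosetCount a) + χ a)      ≡⟨ sum-cong-≗ {q} (λ a → regroup (χ a) (cosetCount a)) ⟩
    sum (λ a → χ a * (3 * cosetCount a + 1))        ≤⟨ sum-mono-≤ pointwise ⟩
    sum (λ a → χ a * n)                             ≡⟨ *-distribʳ-sum n χ ⟨
    sum χ * n                                       ≡⟨ cong (_* n) n≡sum-χ ⟨
    n * n                                           ∎
    where
    open ≤-Reasoning
    regroup : ∀ x m → 3 * (x * m) + x ≡ x * (3 * m + 1)
    regroup = solve-∀
    pointwise : ∀ a → χ a * (3 * cosetCount a + 1) ≤ χ a * n
    pointwise a with a ∈? A
    ... | yes a∈A = *-monoʳ-≤ 1 (subst (_≤ n) (+-comm 1 (3 * cosetCount a)) (small a a∈A))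
    ... | no  _   = z≤n

  large-coset : Nonempty A → ∃ λ a → a ∈ A × n ≤ 3 * cosetCount a
  large-coset A≢∅ with any? (λ a → a ∈? A ×-dec n ≤? 3 * cosetCount a)
  ... | yes found = found
  ... | no  none  = ⊥-elim (counting-contradiction (nonempty⇒∣p∣≥1 A≢∅) n*n≡apart+same
                      (small-cosets⇒samePairs-bound (λ a a∈A → ≰⇒> (λ le → none (a , a∈A , le))))
                      apartPairs-bound)

lemma3 : (q : ℕ) .{{_ : NonZero q}} → Prime q →
         (A : Subset q) → Nonempty A → (∀ x → x ∈ A → toℕ x ≢ 0) →
         Σ (Fin q) λ c → toℕ c ≢ 0 ×
           (Σ (List (Fin q)) λ L → Unique L ×
             All (λ x → x ∈ A × inCoset (Gen (inH A)) c x) L ×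
             ∣ A ∣ ≤ 3 * length L)
lemma3 q q-prime A A≢∅ A⊆F* =
  let a , a∈A , ∣A∣≤3m = large-coset A≢∅ in
  a , A⊆F* a a∈A ,
  filter (A∩coset? a) (allFin q) , filter⁺ (A∩coset? a) (allFin⁺ q) , all-filter (A∩coset? a) (allFin q) ,
  subst (λ m → ∣ A ∣ ≤ 3 * m) (sym (length-filter-tabulate (A∩coset? a) id)) ∣A∣≤3m
  where open Counting q q-prime A A⊆F*
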